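{- Let $s,q\ge1$ be integers with $s\le q$ and let $\Delta\in\mathbb{N}$. Then every separated $(s,q)$-critical graph with maximum degree $\Delta$ has at most $N(q,2\Delta sq)$ edges.
   Context: Two edges $uv$, $xy$ ($u\prec v$, $x\prec y$, four distinct endpoints) of an ordered graph cross if $u\prec x\prec v\prec y$ or $x\prec u\prec y\prec v$ and nest if $u\prec x\prec y\prec v$ or $x\prec u\prec v\prec y$. A stack (queue) is an edge set with no two crossing (nesting) edges; an $s$-stack $q$-queue layout is a partition of the edges into $s$ stacks and $q$ queues with respect to the given order. A separated graph is a bipartite graph with bipartition $V_1\cup V_2$ ordered so that all of $V_1$ precedes all of $V_2$. An ordered graph $G$ is $(s,q)$-critical if it has no $s$-stack $q$-queue layout but $G-e$ has one for every edge $e$. For $r,d\in\mathbb{N}$, $N(r,d)$ denotes the least integer $N$ with the following property: for every set $U$ with $|U|>N$ and every family of partial Boolean functions $P_i:U\setminus\{i\}\to\{0,1\}$ ($i\in U$) such that for all $i,j\in U$ there are at most $d$ points $k\in U\setminus\{i,j\}$ with $P_i(k)\ne P_j(k)$, there exists a total function $P:U\to\{0,1\}$ such that for every $S\subseteq U$ with $|S|\le r+1$ there is $i\in U\setminus S$ with $P(k)=P_i(k)$ for all $k\in S$. (Such $N$ exists, with $N(r,d)\le\min(4r^{d+1},(4r)^{d/2+1})$ for $r\ge2$ and $N(1,d)\le N(2,d)$.) -}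

module Defs where

open import Data.Nat using (ℕ; _+_; _*_; _≤_; _<_)
open import Data.Bool using (Bool; true; false; not; _∧_; _∨_; _xor_)
open import Data.Fin using (Fin; toℕ) renaming (_<_ to _<ᶠ_)
open import Data.Fin.Properties using () renaming (_≟_ to _≟ᶠ_)
open import Data.Fin.Subset using (Subset; _∈_; _∉_; ∣_∣)
open import Data.Vec using (tabulate)
open import Data.List using (List; length; lookup; removeAt; filterᵇ)
open import Data.List.Relation.Unary.All using (All)
open import Data.List.Relation.Unary.Unique.Propositional using (Unique)
open import Data.Product using (Σ; ∃; _×_; _,_; proj₁; proj₂)
open import Data.Sum using (_⊎_; inj₁; inj₂)
open import Relation.Nullary using (¬_; ⌊_⌋)
open import Relation.Binary.PropositionalEquality using (_≡_; _≢_)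

-- Ordered graphs on the vertex set Fin n, ordered by the natural order
-- of Fin n.  An edge is a pair (u , v) with u < v; the edge set is a
-- duplicate-free list of such pairs.

Edge : ℕ → Set
Edge n = Fin n × Fin n

record OrdGraph : Set where
  field
    n       : ℕ
    edges   : List (Edge n)
    ordered : All (λ e → proj₁ e <ᶠ proj₂ e) edges
    simple  : Unique edges
open OrdGraph public

numEdges : OrdGraph → ℕ
numEdges G = length (edges G)

degree : (G : OrdGraph) → Fin (n G) → ℕ
degree G v = length (filterᵇ (λ e → ⌊ proj₁ e ≟ᶠ v ⌋ ∨ ⌊ proj₂ e ≟ᶠ v ⌋) (edges G))

MaxDegree : OrdGraph → ℕ → Set
MaxDegree G Δ = (∀ v → degree G v ≤ Δ) × (∃ λ v → degree G v ≡ Δ)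

-- separated: bipartition V₁ = {v | v < k}, V₂ = {v | k ≤ v} (so V₁
-- precedes V₂) and every edge joins V₁ to V₂.
Separated : OrdGraph → Set
Separated G = ∃ λ (k : ℕ) → All (λ e → toℕ (proj₁ e) < k × k ≤ toℕ (proj₂ e)) (edges G)

-- Crossing and nesting (for edges (u,v), (x,y) with u<v, x<y; the strict
-- chains force the four endpoints to be distinct).

Cross : ∀ {n} → Edge n → Edge n → Set
Cross (u , v) (x , y) = (u <ᶠ x × x <ᶠ v × v <ᶠ y) ⊎ (x <ᶠ u × u <ᶠ y × y <ᶠ v)

Nest : ∀ {n} → Edge n → Edge n → Set
Nest (u , v) (x , y) = (u <ᶠ x × x <ᶠ y × y <ᶠ v) ⊎ (x <ᶠ u × u <ᶠ v × v <ᶠ y)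

-- s-stack q-queue layout of an edge list: each edge gets either a stack
-- label (inj₁) or a queue label (inj₂); edges in the same stack do not
-- cross, edges in the same queue do not nest.
HasLayout : ℕ → ℕ → ∀ {n} → List (Edge n) → Set
HasLayout s q es =
  Σ (Fin (length es) → Fin s ⊎ Fin q) λ c →
    (∀ a b t → c a ≡ inj₁ t → c b ≡ inj₁ t → ¬ Cross (lookup es a) (lookup es b)) ×
    (∀ a b t → c a ≡ inj₂ t → c b ≡ inj₂ t → ¬ Nest (lookup es a) (lookup es b))

Critical : ℕ → ℕ → OrdGraph → Set
Critical s q G =
  ¬ HasLayout s q (edges G) × (∀ i → HasLayout s q (removeAt (edges G) i))

diffCount : ∀ {m} → (Fin m → Fin m → Bool) → Fin m → Fin m → ℕ
diffCount P i j =
  ∣ tabulate (λ k → not ⌊ k ≟ᶠ i ⌋ ∧ not ⌊ k ≟ᶠ j ⌋ ∧ (P i k xor P j k)) ∣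

-- The ground
-- set U is Fin m; the family (P_i)_{i∈U} is P i : Fin m → Bool, where
-- the value P i i is irrelevant (P_i is only defined on U∖{i}).
NProperty : ℕ → ℕ → ℕ → Set
NProperty r d N =
  ∀ (m : ℕ) → N < m → (P : Fin m → Fin m → Bool) →
  (∀ i j → diffCount P i j ≤ d) →
  ∃ λ (Q : Fin m → Bool) →
    ∀ (S : Subset m) → ∣ S ∣ ≤ r + 1 →
      ∃ λ i → i ∉ S × (∀ k → k ∈ S → Q k ≡ P i k)

IsN : ℕ → ℕ → ℕ → Set
IsN r d N = NProperty r d N × (∀ M → NProperty r d M → N ≤ M)

module Submission where

-- For every edge i fix an s-stack q-queue layout of G − i and let Pᵢ(k) say whether edge k lies on a
-- stack in it. In a separated graph two edges that neither cross nor nest share an endpoint, so the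
-- edges lying on stack t in layout i and on queue t′ in layout j (or vice versa) form a star: Pᵢ and Pⱼ
-- differ on at most 2Δsq edges. If G had more than N(q, 2Δsq) edges, the defining property of N gives a
-- colouring Q which on every set of at most q + 1 edges agrees with some Pᵢ, i outside the set. Put the
-- Q-edges on stacks and the rest on queues. Among the Q-edges crossing is a partial order without chains
-- of s + 1 ≤ q + 1 edges, since pigeonhole would place two crossing edges of such a chain on one stack of
-- the layout of G − i agreeing with Q on it; by Mirsky's theorem s stacks suffice. Nesting and q queues
-- are handled alike, and the resulting layout of G contradicts criticality.

open import Defs
open import Data.Bool using (Bool; true; false; T; not; _∧_; _∨_; _xor_)
open import Data.Bool.Properties using (T-∨)
open import Data.Empty using (⊥-elim)
open import Data.Fin using (Fin; zero; suc; toℕ; fromℕ<; combine; remQuot) renaming (_<_ to _<ᶠ_)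
open import Data.Fin.Properties
  using (_≟_; suc-injective; any?; pigeonhole; toℕ-fromℕ<; remQuot-combine)
  renaming (_<?_ to _<ᶠ?_; <-trans to <ᶠ-trans; <-cmp to <ᶠ-cmp)
open import Data.Fin.Subset using (Subset; ∣_∣; _∈_; _∉_)
open import Data.List using (List; []; _∷_; length; lookup; removeAt; filterᵇ)
open import Data.List.Membership.Propositional.Properties using (∈-lookup)
import Data.List.Relation.Unary.All as All
open import Data.Nat using (ℕ; zero; suc; _+_; _*_; _≤_; _<_; _⊔_; z≤n; s≤s; s≤s⁻¹; _≤?_)
open import Data.Nat.Properties
  using (module ≤-Reasoning; ≤-trans; ≤-reflexive; <-≤-trans; <-irrefl; ≰⇒>; n<1+n; n≤1+n;
         m≤n⇒m≤1+n; +-mono-≤; +-monoʳ-≤; +-suc; +-comm; *-identityʳ; m≤m⊔n; m≤n⊔m; ⊔-sel)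
open import Data.Nat.Tactic.RingSolver using (solve-∀)
open import Data.Product using (∃; ∃₂; _×_; _,_; proj₁; proj₂; uncurry)
import Data.Product as Product
open import Data.Sum using (_⊎_; inj₁; inj₂)
import Data.Sum as Sum
open import Data.Sum.Properties using () renaming (≡-dec to ⊎-≡-dec)
open import Data.Vec using (tabulate)
import Data.Vec.Functional as Vector
open import Data.Vec.Properties using (lookup⇒[]=; lookup∘tabulate)
open import Function using (_∘_; id; case_of_; Equivalence)
open import Level using (Level) renaming (_⊔_ to _⊔ˡ_)
open import Relation.Binary using (Rel; Transitive; tri<; tri≈; tri>)
open import Relation.Binary.PropositionalEquality
  using (_≡_; _≢_; refl; sym; trans; cong; cong₂; subst; subst₂)
open import Relation.Nullary using (¬_; Dec; yes; no; does; ⌊_⌋; _×-dec_; ¬?)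
open import Relation.Nullary.Decidable using (T?; dec-true; fromWitness; decidable-stable)
open import Relation.Unary using (Pred; Decidable; _⊆_; _∪_; _∩_; ∁; ∅)
open import Relation.Unary.Properties using (_∪?_; _∩?_; ∁?)

private variable ℓ ℓ₁ ℓ₂ : Level

toSubset : ∀ {m} {P : Pred (Fin m) ℓ} → Decidable P → Subset m
toSubset P? = tabulate (does ∘ P?)

count : ∀ {m} {P : Pred (Fin m) ℓ} → Decidable P → ℕ
count P? = ∣ toSubset P? ∣

count-mono : ∀ {m} {P : Pred (Fin m) ℓ₁} {Q : Pred (Fin m) ℓ₂}
             (P? : Decidable P) (Q? : Decidable Q) → P ⊆ Q → count P? ≤ count Q?
count-mono {m = zero} P? Q? P⊆Q = z≤n
count-mono {m = suc m} P? Q? P⊆Q with P? zero | Q? zero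
... | yes _  | yes _  = s≤s (count-mono (P? ∘ suc) (Q? ∘ suc) P⊆Q)
... | yes p  | no ¬q  = ⊥-elim (¬q (P⊆Q p))
... | no _   | yes _  = m≤n⇒m≤1+n (count-mono (P? ∘ suc) (Q? ∘ suc) P⊆Q)
... | no _   | no _   = count-mono (P? ∘ suc) (Q? ∘ suc) P⊆Q

count-∪ : ∀ {m} {P : Pred (Fin m) ℓ₁} {Q : Pred (Fin m) ℓ₂}
          (P? : Decidable P) (Q? : Decidable Q) → count (P? ∪? Q?) ≤ count P? + count Q?
count-∪ {m = zero} P? Q? = z≤n
count-∪ {m = suc m} P? Q? with P? zero | Q? zero
... | yes _ | yes _ = s≤s (≤-trans (count-∪ (P? ∘ suc) (Q? ∘ suc)) (+-monoʳ-≤ _ (n≤1+n _)))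
... | yes _ | no _  = s≤s (count-∪ (P? ∘ suc) (Q? ∘ suc))
... | no _  | yes _ = ≤-trans (s≤s (count-∪ (P? ∘ suc) (Q? ∘ suc))) (≤-reflexive (sym (+-suc _ _)))
... | no _  | no _  = count-∪ (P? ∘ suc) (Q? ∘ suc)

count-∅ : ∀ {m} {P : Pred (Fin m) ℓ} (P? : Decidable P) → P ⊆ ∅ → count P? ≡ 0
count-∅ {m = zero} P? P⊆∅ = refl
count-∅ {m = suc m} P? P⊆∅ with P? zero
... | yes p = ⊥-elim (P⊆∅ p)
... | no _  = count-∅ (P? ∘ suc) P⊆∅

count-cover : ∀ {T c m} {P : Pred (Fin m) ℓ₁} {Q : Fin T → Pred (Fin m) ℓ₂}
              (P? : Decidable P) (Q? : ∀ t → Decidable (Q t)) →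
              (∀ {k} → P k → ∃ λ t → Q t k) → (∀ t → count (Q? t) ≤ c) → count P? ≤ T * c
count-cover {T = zero} P? Q? cover _ = ≤-reflexive (count-∅ P? (λ pk → case cover pk of λ ()))
count-cover {T = suc T} {c} {P = P} {Q} P? Q? cover bound = begin
  count P?                   ≤⟨ count-mono P? (Q? zero ∪? R?) split ⟩
  count (Q? zero ∪? R?)      ≤⟨ count-∪ (Q? zero) R? ⟩
  count (Q? zero) + count R? ≤⟨ +-mono-≤ (bound zero) (count-cover R? (Q? ∘ suc) cover′ (bound ∘ suc)) ⟩
  c + T * c                  ∎
  where
  open ≤-Reasoning
  R? = P? ∩? ∁? (Q? zero)
  split : P ⊆ Q zero ∪ (P ∩ ∁ (Q zero))
  split {k} pk with Q? zero k
  ... | yes q = inj₁ q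
  ... | no ¬q = inj₂ (pk , ¬q)
  cover′ : ∀ {k} → (P ∩ ∁ (Q zero)) k → ∃ λ t → Q (suc t) k
  cover′ (pk , ¬q) with cover pk
  ... | zero  , q = ⊥-elim (¬q q)
  ... | suc t , q = t , q

count-≡≤1 : ∀ {m} (x : Fin m) → count (x ≟_) ≤ 1
count-≡≤1 {suc m} zero = s≤s (≤-reflexive (count-∅ {m = m} (λ k → zero ≟ suc k) λ ()))
count-≡≤1 {suc m} (suc x) = ≤-trans (count-mono (λ k → suc x ≟ suc k) (x ≟_) suc-injective) (count-≡≤1 x)

∈-toSubset : ∀ {m} {P : Pred (Fin m) ℓ} (P? : Decidable P) {k} → P k → k ∈ toSubset P?
∈-toSubset P? {k} pk = lookup⇒[]= k _ (trans (lookup∘tabulate (does ∘ P?) k) (dec-true (P? k) pk))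

count≡length-filterᵇ : ∀ {a} {A : Set a} (p : A → Bool) (xs : List A) →
                       count (λ k → T? (p (lookup xs k))) ≡ length (filterᵇ p xs)
count≡length-filterᵇ p [] = refl
count≡length-filterᵇ p (x ∷ xs) with p x
... | true  = cong suc (count≡length-filterᵇ p xs)
... | false = count≡length-filterᵇ p xs

LocallyAgrees : ∀ {m} → ℕ → (Fin m → Fin m → Bool) → (Fin m → Bool) → Set
LocallyAgrees {m} r P Q = ∀ (S : Subset m) → ∣ S ∣ ≤ r + 1 → ∃ λ i → i ∉ S × (∀ k → k ∈ S → Q k ≡ P i k)

agreement-on-family : ∀ {m r} {P : Fin m → Fin m → Bool} {Q : Fin m → Bool} → LocallyAgrees r P Q →
                      ∀ {L} → L ≤ r + 1 → (ch : Fin L → Fin m) →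
                      ∃ λ i → (∀ t → ch t ≢ i) × (∀ t → Q (ch t) ≡ P i (ch t))
agreement-on-family agrees {L} L≤r+1 ch = i , avoids , (λ t → agree (ch t) (ch∈S t))
  where
  image? : Decidable (λ k → ∃ λ t → ch t ≡ k)
  image? k = any? (λ t → ch t ≟ k)
  S = toSubset image?
  ch∈S : ∀ t → ch t ∈ S
  ch∈S t = ∈-toSubset image? (t , refl)
  ∣S∣≤r+1 : count image? ≤ _
  ∣S∣≤r+1 = ≤-trans (count-cover image? (λ t → ch t ≟_) id (count-≡≤1 ∘ ch))
                    (≤-trans (≤-reflexive (*-identityʳ L)) L≤r+1)
  found = agrees S ∣S∣≤r+1
  i = proj₁ found
  agree = proj₂ (proj₂ found)
  avoids : ∀ t → ch t ≢ i
  avoids t ch≡i = proj₁ (proj₂ found) (subst (_∈ S) ch≡i (ch∈S t))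

maxᶠ : ∀ {m} → (Fin m → ℕ) → ℕ
maxᶠ {zero}  g = 0
maxᶠ {suc m} g = g zero ⊔ maxᶠ (g ∘ suc)

≤-maxᶠ : ∀ {m} (g : Fin m → ℕ) t → g t ≤ maxᶠ g
≤-maxᶠ g zero    = m≤m⊔n _ _
≤-maxᶠ g (suc t) = ≤-trans (≤-maxᶠ (g ∘ suc) t) (m≤n⊔m _ _)

maxᶠ-cong : ∀ {m} {g h : Fin m → ℕ} → (∀ t → g t ≡ h t) → maxᶠ g ≡ maxᶠ h
maxᶠ-cong {zero}  g≗h = refl
maxᶠ-cong {suc m} g≗h = cong₂ _⊔_ (g≗h zero) (maxᶠ-cong (g≗h ∘ suc))

<-maxᶠ⇒ : ∀ {m n} (g : Fin m → ℕ) → n < maxᶠ g → ∃ λ t → n < g t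
<-maxᶠ⇒ {suc m} g n<max with ⊔-sel (g zero) (maxᶠ (g ∘ suc))
... | inj₁ eq = zero , subst (_ <_) eq n<max
... | inj₂ eq = Product.map suc id (<-maxᶠ⇒ (g ∘ suc) (subst (_ <_) eq n<max))

Layering : ∀ {m} → Pred (Fin m) ℓ₁ → Rel (Fin m) ℓ₂ → ℕ → (Fin m → ℕ) → Set (ℓ₁ ⊔ˡ ℓ₂)
Layering A R L h = (∀ k → A k → h k < L) × (∀ {j k} → A j → R j k → h j < h k)

module Mirsky {m} {A : Pred (Fin m) ℓ₁} (A? : Decidable A)
              {R : Rel (Fin m) ℓ₂} (R? : ∀ j k → Dec (R j k)) (R-trans : Transitive R)
              (rank : Fin m → ℕ) (rank-mono : ∀ {j k} → R j k → rank j < rank k) where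

  Chain : ∀ {L} → (Fin L → Fin m) → Set (ℓ₁ ⊔ˡ ℓ₂)
  Chain ch = (∀ t → A (ch t)) × (∀ {a b} → a <ᶠ b → R (ch b) (ch a))

  -- height f k is the length of a longest R-chain of A-elements below k, computed with recursion
  -- depth f; depth f > rank k suffices (height-stable).
  mutual
    height : ℕ → Fin m → ℕ
    height zero    k = 0
    height (suc f) k = maxᶠ (height-through f k)

    height-through : ℕ → Fin m → Fin m → ℕ
    height-through f k j with A? j ×-dec R? j k
    ... | yes _ = suc (height f j)
    ... | no  _ = 0

  height-through-≡ : ∀ {f j k} → A j → R j k → height-through f k j ≡ suc (height f j)
  height-through-≡ {f} {j} {k} aj rjk with A? j ×-dec R? j k
  ... | yes _ = refl
  ... | no ¬p = ⊥-elim (¬p (aj , rjk))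

  height-through-positive : ∀ {f j k n} → suc n ≤ height-through f k j → A j × R j k × n ≤ height f j
  height-through-positive {f} {j} {k} le with A? j ×-dec R? j k
  ... | yes (aj , rjk) = aj , rjk , s≤s⁻¹ le

  height-stable : ∀ {f k} → rank k < f → height (suc f) k ≡ height f k
  height-stable {suc f} {k} rk<f = maxᶠ-cong via-stable
    where
    via-stable : ∀ j → height-through (suc f) k j ≡ height-through f k j
    via-stable j with A? j ×-dec R? j k
    ... | yes (_ , rjk) = cong suc (height-stable (<-≤-trans (rank-mono rjk) (s≤s⁻¹ rk<f)))
    ... | no  _         = refl

  height-step : ∀ {f j k} → A j → R j k → height f j < height (suc f) k
  height-step {f} {j} {k} aj rjk = ≤-trans (≤-reflexive (sym (height-through-≡ aj rjk))) (≤-maxᶠ (height-through f k) j)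

  height⇒chain : ∀ {f k} n → n ≤ height f k → A k → ∃ λ (ch : Fin (suc n) → Fin m) → ch zero ≡ k × Chain ch
  height⇒chain {f} {k} zero _ ak = (λ _ → k) , refl , (λ _ → ak) , λ { {zero} {zero} () }
  height⇒chain {suc f} {k} (suc n) n<h ak with <-maxᶠ⇒ (height-through f k) n<h
  ... | j , n<via with height-through-positive {f} n<via
  ... | aj , rjk , n≤hj with height⇒chain {f} n n≤hj aj
  ... | ch , refl , all-A , descending = k Vector.∷ ch , refl , all-A′ , descending′
    where
    all-A′ : ∀ t → A ((k Vector.∷ ch) t)
    all-A′ zero    = ak
    all-A′ (suc t) = all-A t
    below-k : ∀ t → R (ch t) k
    below-k zero    = rjk
    below-k (suc t) = R-trans (descending {zero} {suc t} (s≤s z≤n)) rjk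
    descending′ : ∀ {a b} → a <ᶠ b → R ((k Vector.∷ ch) b) ((k Vector.∷ ch) a)
    descending′ {zero}  {suc b} _   = below-k b
    descending′ {suc a} {suc b} a<b = descending (s≤s⁻¹ a<b)

  mirsky : ∀ L → (∀ (ch : Fin (suc L) → Fin m) → ¬ Chain ch) → ∃ (Layering A R L)
  mirsky L no-chain = height F , bounded , increasing
    where
    F = suc (maxᶠ rank)
    rank<F : ∀ k → rank k < F
    rank<F k = s≤s (≤-maxᶠ rank k)
    bounded : ∀ k → A k → height F k < L
    bounded k ak = ≰⇒> λ L≤h → let ch , _ , chain = height⇒chain L L≤h ak in no-chain ch chain
    increasing : ∀ {j k} → A j → R j k → height F j < height F k
    increasing {k = k} aj rjk = subst (_ <_) (height-stable (rank<F k)) (height-step aj rjk)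

removeAtIndex : ∀ {a} {A : Set a} (xs : List A) {i k : Fin (length xs)} → k ≢ i → Fin (length (removeAt xs i))
removeAtIndex (x ∷ xs) {zero}  {zero}  k≢i = ⊥-elim (k≢i refl)
removeAtIndex (x ∷ xs) {zero}  {suc k} _   = k
removeAtIndex (x ∷ xs) {suc i} {zero}  _   = zero
removeAtIndex (x ∷ xs) {suc i} {suc k} k≢i = suc (removeAtIndex xs (k≢i ∘ cong suc))

lookup-removeAtIndex : ∀ {a} {A : Set a} (xs : List A) {i k} (k≢i : k ≢ i) →
                       lookup (removeAt xs i) (removeAtIndex xs k≢i) ≡ lookup xs k
lookup-removeAtIndex (x ∷ xs) {zero}  {zero}  k≢i = ⊥-elim (k≢i refl)
lookup-removeAtIndex (x ∷ xs) {zero}  {suc k} _   = refl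
lookup-removeAtIndex (x ∷ xs) {suc i} {zero}  _   = refl
lookup-removeAtIndex (x ∷ xs) {suc i} {suc k} k≢i = lookup-removeAtIndex xs (k≢i ∘ cong suc)

T-not∧ : ∀ {a} {A : Set a} (a? : Dec A) {b} → T (not ⌊ a? ⌋ ∧ b) → ¬ A × T b
T-not∧ (yes _)  ()
T-not∧ (no ¬a) tb = ¬a , tb

isInj₁ᵇ : ∀ {a b} {A : Set a} {B : Set b} → A ⊎ B → Bool
isInj₁ᵇ (inj₁ _) = true
isInj₁ᵇ (inj₂ _) = false

inj₁-witness : ∀ {a b} {A : Set a} {B : Set b} (c : A ⊎ B) → T (isInj₁ᵇ c) → ∃ λ x → c ≡ inj₁ x
inj₁-witness (inj₁ x) _ = x , refl

inj₂-witness : ∀ {a b} {A : Set a} {B : Set b} (c : A ⊎ B) → ¬ T (isInj₁ᵇ c) → ∃ λ y → c ≡ inj₂ y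
inj₂-witness (inj₁ _) not-inj₁ = ⊥-elim (not-inj₁ _)
inj₂-witness (inj₂ y) _        = y , refl

inj₁-xor-inj₂ : ∀ {a b} {A : Set a} {B : Set b} (c c′ : A ⊎ B) → T (isInj₁ᵇ c xor isInj₁ᵇ c′) →
                (∃₂ λ x y → c ≡ inj₁ x × c′ ≡ inj₂ y) ⊎ (∃₂ λ x y → c ≡ inj₂ y × c′ ≡ inj₁ x)
inj₁-xor-inj₂ (inj₁ x) (inj₂ y) _ = inj₁ (x , y , refl , refl)
inj₁-xor-inj₂ (inj₂ y) (inj₁ x) _ = inj₂ (x , y , refl , refl)

pigeonhole-inj₁ : ∀ {L s} {B : Set} → s < L → (c : Fin L → Fin s ⊎ B) → (∀ t → T (isInj₁ᵇ (c t))) →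
                  ∃₂ λ a b → a <ᶠ b × ∃ λ τ → c a ≡ inj₁ τ × c b ≡ inj₁ τ
pigeonhole-inj₁ s<L c inj₁s with pigeonhole s<L (λ t → proj₁ (inj₁-witness (c t) (inj₁s t)))
... | a , b , a<b , same =
  a , b , a<b , _ , proj₂ (inj₁-witness (c a) (inj₁s a)) ,
  trans (proj₂ (inj₁-witness (c b) (inj₁s b))) (cong inj₁ (sym same))

pigeonhole-inj₂ : ∀ {L q} {A : Set} → q < L → (c : Fin L → A ⊎ Fin q) → (∀ t → ¬ T (isInj₁ᵇ (c t))) →
                  ∃₂ λ a b → a <ᶠ b × ∃ λ τ → c a ≡ inj₂ τ × c b ≡ inj₂ τ
pigeonhole-inj₂ q<L c inj₂s with pigeonhole q<L (λ t → proj₁ (inj₂-witness (c t) (inj₂s t)))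
... | a , b , a<b , same =
  a , b , a<b , _ , proj₂ (inj₂-witness (c a) (inj₂s a)) ,
  trans (proj₂ (inj₂-witness (c b) (inj₂s b))) (cong inj₂ (sym same))

star-centre : ∀ {ℓ m n} {Y : Pred (Fin m) ℓ} → Decidable Y → (u v : Fin m → Fin n) →
              (∀ {k k′} → Y k → Y k′ → u k ≡ u k′ ⊎ v k ≡ v k′) →
              ∀ {k₀} → Y k₀ → ∃ λ w → ∀ {k} → Y k → u k ≡ w ⊎ v k ≡ w
star-centre Y? u v share {k₀} y₀ with any? (λ k → Y? k ×-dec ¬? (u k ≟ u k₀))
... | no all-at-u₀ = u k₀ , λ {k} y → inj₁ (decidable-stable (u k ≟ u k₀) (λ uk≢u₀ → all-at-u₀ (k , y , uk≢u₀)))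
... | yes (k₁ , y₁ , u₁≢u₀) = v k₀ , at-v₀
  where
  at-v₀ : ∀ {k} → _ → u k ≡ v k₀ ⊎ v k ≡ v k₀
  at-v₀ y with share y y₀ | share y y₁ | share y₀ y₁
  ... | inj₂ vk≡v₀ | _          | _          = inj₂ vk≡v₀
  ... | inj₁ uk≡u₀ | inj₁ uk≡u₁ | _          = ⊥-elim (u₁≢u₀ (trans (sym uk≡u₁) uk≡u₀))
  ... | inj₁ _     | inj₂ _     | inj₁ u₀≡u₁ = ⊥-elim (u₁≢u₀ (sym u₀≡u₁))
  ... | inj₁ _     | inj₂ vk≡v₁ | inj₂ v₀≡v₁ = inj₂ (trans vk≡v₁ (sym v₀≡v₁))

module SeparatedGraph (G : OrdGraph) (separated : Separated G) where

  edge : Fin (numEdges G) → Edge (n G)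
  edge = lookup (edges G)

  u v : Fin (numEdges G) → Fin (n G)
  u = proj₁ ∘ edge
  v = proj₂ ∘ edge

  u<v : ∀ k → u k <ᶠ v k
  u<v k = All.lookup (ordered G) (∈-lookup k)

  u<v′ : ∀ j k → u j <ᶠ v k
  u<v′ j k = <-≤-trans (proj₁ (sides j)) (proj₂ (sides k))
    where sides = λ k → All.lookup (proj₂ separated) (∈-lookup k)

  Crossing Nesting : Rel (Fin (numEdges G)) _
  Crossing j k = u j <ᶠ u k × v j <ᶠ v k
  Nesting  j k = u j <ᶠ u k × v k <ᶠ v j

  crossing? : ∀ j k → Dec (Crossing j k)
  crossing? j k = (u j <ᶠ? u k) ×-dec (v j <ᶠ? v k)

  nesting? : ∀ j k → Dec (Nesting j k)
  nesting? j k = (u j <ᶠ? u k) ×-dec (v k <ᶠ? v j)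

  crossing-trans : Transitive Crossing
  crossing-trans (u₁ , v₁) (u₂ , v₂) = <ᶠ-trans u₁ u₂ , <ᶠ-trans v₁ v₂

  nesting-trans : Transitive Nesting
  nesting-trans (u₁ , v₁) (u₂ , v₂) = <ᶠ-trans u₁ u₂ , <ᶠ-trans v₂ v₁

  Crossing⇒Cross : ∀ {j k} → Crossing j k → Cross (edge j) (edge k)
  Crossing⇒Cross {j} {k} (uj<uk , vj<vk) = inj₁ (uj<uk , u<v′ k j , vj<vk)

  Nesting⇒Nest : ∀ {j k} → Nesting j k → Nest (edge j) (edge k)
  Nesting⇒Nest {j} {k} (uj<uk , vk<vj) = inj₁ (uj<uk , u<v k , vk<vj)

  Cross⇒Crossing : ∀ {j k} → Cross (edge j) (edge k) → Crossing j k ⊎ Crossing k j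
  Cross⇒Crossing (inj₁ (uj<uk , _ , vj<vk)) = inj₁ (uj<uk , vj<vk)
  Cross⇒Crossing (inj₂ (uk<uj , _ , vk<vj)) = inj₂ (uk<uj , vk<vj)

  Nest⇒Nesting : ∀ {j k} → Nest (edge j) (edge k) → Nesting j k ⊎ Nesting k j
  Nest⇒Nesting (inj₁ (uj<uk , _ , vk<vj)) = inj₁ (uj<uk , vk<vj)
  Nest⇒Nesting (inj₂ (uk<uj , _ , vj<vk)) = inj₂ (uk<uj , vj<vk)

  share-endpoint : ∀ {j k} → ¬ Cross (edge j) (edge k) → ¬ Nest (edge j) (edge k) → u j ≡ u k ⊎ v j ≡ v k
  share-endpoint {j} {k} ¬cross ¬nest with <ᶠ-cmp (u j) (u k) | <ᶠ-cmp (v j) (v k)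
  ... | tri≈ _ uj≡uk _ | _              = inj₁ uj≡uk
  ... | _              | tri≈ _ vj≡vk _ = inj₂ vj≡vk
  ... | tri< uj<uk _ _ | tri< vj<vk _ _ = ⊥-elim (¬cross (Crossing⇒Cross (uj<uk , vj<vk)))
  ... | tri< uj<uk _ _ | tri> _ _ vk<vj = ⊥-elim (¬nest (Nesting⇒Nest (uj<uk , vk<vj)))
  ... | tri> _ _ uk<uj | tri< vj<vk _ _ = ⊥-elim (¬nest (Sum.swap (Nesting⇒Nest (uk<uj , vj<vk))))
  ... | tri> _ _ uk<uj | tri> _ _ vk<vj = ⊥-elim (¬cross (Sum.swap (Crossing⇒Cross (uk<uj , vk<vj))))

  count-pairwise-adjacent≤Δ : ∀ {ℓ Δ} {Y : Pred (Fin (numEdges G)) ℓ} (Y? : Decidable Y) → (∀ w → degree G w ≤ Δ) →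
                    (∀ {k k′} → Y k → Y k′ → u k ≡ u k′ ⊎ v k ≡ v k′) → count Y? ≤ Δ
  count-pairwise-adjacent≤Δ Y? deg≤Δ share with any? Y?
  ... | no empty = ≤-trans (≤-reflexive (count-∅ Y? (λ y → empty (_ , y)))) z≤n
  ... | yes (_ , y₀) with star-centre Y? u v share y₀
  ... | w , at-w = begin
    count Y?                             ≤⟨ count-mono Y? (λ k → T? (incident (edge k))) (incident-at-w ∘ at-w) ⟩
    count (λ k → T? (incident (edge k))) ≡⟨ count≡length-filterᵇ incident (edges G) ⟩
    degree G w                           ≤⟨ deg≤Δ w ⟩
    _                                    ∎
    where
    open ≤-Reasoning
    incident : Edge (n G) → Bool
    incident e = ⌊ proj₁ e ≟ w ⌋ ∨ ⌊ proj₂ e ≟ w ⌋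
    incident-at-w : ∀ {k} → u k ≡ w ⊎ v k ≡ w → T (incident (edge k))
    incident-at-w {k} = Equivalence.from T-∨ ∘ Sum.map (fromWitness {a? = u k ≟ w}) (fromWitness {a? = v k ≟ w})

  layout-from-layerings : ∀ {s q} (Q : Fin (numEdges G) → Bool) {hS hQ : Fin (numEdges G) → ℕ} →
                          Layering (T ∘ Q) Crossing s hS → Layering (¬_ ∘ T ∘ Q) Nesting q hQ →
                          HasLayout s q (edges G)
  layout-from-layerings {s} {q} Q {hS} {hQ} (hS<s , hS-mono) (hQ<q , hQ-mono) = colour , stacks , queues
    where
    colour : Fin (numEdges G) → Fin s ⊎ Fin q
    colour k with T? (Q k)
    ... | yes qk = inj₁ (fromℕ< (hS<s k qk))
    ... | no ¬qk = inj₂ (fromℕ< (hQ<q k ¬qk))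

    colour-inj₁ : ∀ {k t} → colour k ≡ inj₁ t → T (Q k) × hS k ≡ toℕ t
    colour-inj₁ {k} eq with T? (Q k)
    colour-inj₁ refl | yes qk = qk , sym (toℕ-fromℕ< _)

    colour-inj₂ : ∀ {k t} → colour k ≡ inj₂ t → ¬ T (Q k) × hQ k ≡ toℕ t
    colour-inj₂ {k} eq with T? (Q k)
    colour-inj₂ refl | no ¬qk = ¬qk , sym (toℕ-fromℕ< _)

    stacks : ∀ a b t → colour a ≡ inj₁ t → colour b ≡ inj₁ t → ¬ Cross (edge a) (edge b)
    stacks a b t ca cb cross with colour-inj₁ ca | colour-inj₁ cb | Cross⇒Crossing cross
    ... | qa , ha | _  , hb | inj₁ a↗b = <-irrefl (trans ha (sym hb)) (hS-mono qa a↗b)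
    ... | _  , ha | qb , hb | inj₂ b↗a = <-irrefl (trans hb (sym ha)) (hS-mono qb b↗a)

    queues : ∀ a b t → colour a ≡ inj₂ t → colour b ≡ inj₂ t → ¬ Nest (edge a) (edge b)
    queues a b t ca cb nest with colour-inj₂ ca | colour-inj₂ cb | Nest⇒Nesting nest
    ... | qa , ha | _  , hb | inj₁ a↘b = <-irrefl (trans ha (sym hb)) (hQ-mono qa a↘b)
    ... | _  , ha | qb , hb | inj₂ b↘a = <-irrefl (trans hb (sym ha)) (hQ-mono qb b↘a)

  module Deletions {s q} (junk : Fin s ⊎ Fin q) (layout : ∀ i → HasLayout s q (removeAt (edges G) i)) where

    colour : Fin (numEdges G) → Fin (numEdges G) → Fin s ⊎ Fin q
    colour i k with k ≟ i
    ... | yes _   = junk  -- the deleted edge itself has no colour; it is never inspected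
    ... | no k≢i  = proj₁ (layout i) (removeAtIndex (edges G) k≢i)

    stack-safe : ∀ {i a b t} → a ≢ i → b ≢ i → colour i a ≡ inj₁ t → colour i b ≡ inj₁ t → ¬ Cross (edge a) (edge b)
    stack-safe {i} {a} {b} {t} a≢i b≢i ca cb with a ≟ i | b ≟ i
    ... | yes a≡i | _       = ⊥-elim (a≢i a≡i)
    ... | no _    | yes b≡i = ⊥-elim (b≢i b≡i)
    ... | no a≢i′ | no b≢i′ =
      subst₂ (λ x y → ¬ Cross x y) (lookup-removeAtIndex (edges G) a≢i′) (lookup-removeAtIndex (edges G) b≢i′)
             (proj₁ (proj₂ (layout i)) _ _ t ca cb)

    queue-safe : ∀ {i a b t} → a ≢ i → b ≢ i → colour i a ≡ inj₂ t → colour i b ≡ inj₂ t → ¬ Nest (edge a) (edge b)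
    queue-safe {i} {a} {b} {t} a≢i b≢i ca cb with a ≟ i | b ≟ i
    ... | yes a≡i | _       = ⊥-elim (a≢i a≡i)
    ... | no _    | yes b≡i = ⊥-elim (b≢i b≡i)
    ... | no a≢i′ | no b≢i′ =
      subst₂ (λ x y → ¬ Nest x y) (lookup-removeAtIndex (edges G) a≢i′) (lookup-removeAtIndex (edges G) b≢i′)
             (proj₂ (proj₂ (layout i)) _ _ t ca cb)

    onStack : Fin (numEdges G) → Fin (numEdges G) → Bool
    onStack i k = isInj₁ᵇ (colour i k)

    Mixed : Fin (numEdges G) → Fin (numEdges G) → Fin s → Fin q → Pred (Fin (numEdges G)) _
    Mixed i j t t′ k = k ≢ i × k ≢ j × colour i k ≡ inj₁ t × colour j k ≡ inj₂ t′

    mixed? : ∀ i j t t′ → Decidable (Mixed i j t t′)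
    mixed? i j t t′ k = ¬? (k ≟ i) ×-dec ¬? (k ≟ j) ×-dec colour i k ≟ᶜ inj₁ t ×-dec colour j k ≟ᶜ inj₂ t′
      where _≟ᶜ_ = ⊎-≡-dec _≟_ _≟_

    count-mixed≤Δ : ∀ {Δ} → (∀ w → degree G w ≤ Δ) → ∀ i j t t′ → count (mixed? i j t t′) ≤ Δ
    count-mixed≤Δ deg≤Δ i j t t′ = count-pairwise-adjacent≤Δ (mixed? i j t t′) deg≤Δ λ where
      (k≢i , k≢j , ik , jk) (k′≢i , k′≢j , ik′ , jk′) →
        share-endpoint (stack-safe k≢i k′≢i ik ik′) (queue-safe k≢j k′≢j jk jk′)

    diffCount-onStack : ∀ {Δ} → (∀ w → degree G w ≤ Δ) → ∀ i j → diffCount onStack i j ≤ 2 * Δ * s * q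
    diffCount-onStack {Δ} deg≤Δ i j = begin
      diffCount onStack i j ≤⟨ count-cover (T? ∘ differ) (λ x → uncurry either? (remQuot q x)) cover bound ⟩
      s * q * (Δ + Δ)       ≡⟨ arithmetic s q Δ ⟩
      2 * Δ * s * q         ∎
      where
      open ≤-Reasoning
      arithmetic : ∀ s q Δ → s * q * (Δ + Δ) ≡ 2 * Δ * s * q
      arithmetic = solve-∀

      differ : Fin (numEdges G) → Bool
      differ k = not ⌊ k ≟ i ⌋ ∧ not ⌊ k ≟ j ⌋ ∧ (isInj₁ᵇ (colour i k) xor isInj₁ᵇ (colour j k))

      Either : Fin s → Fin q → Pred (Fin (numEdges G)) _
      Either t t′ = Mixed i j t t′ ∪ Mixed j i t t′

      either? : ∀ t t′ → Decidable (Either t t′)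
      either? t t′ = mixed? i j t t′ ∪? mixed? j i t t′

      indexed : ∀ {t t′ k} → Either t t′ k → ∃ λ x → uncurry Either (remQuot q x) k
      indexed {t} {t′} {k} e = combine t t′ , subst (λ x → uncurry Either x k) (sym (remQuot-combine t t′)) e

      cover : ∀ {k} → T (differ k) → ∃ λ x → uncurry Either (remQuot q x) k
      cover {k} d with T-not∧ (k ≟ i) d
      ... | k≢i , d′ with T-not∧ (k ≟ j) d′
      ... | k≢j , d″ with inj₁-xor-inj₂ (colour i k) (colour j k) d″
      ... | inj₁ (t , t′ , ci , cj) = indexed {t} {t′} (inj₁ (k≢i , k≢j , ci , cj))
      ... | inj₂ (t , t′ , ci , cj) = indexed {t} {t′} (inj₂ (k≢j , k≢i , cj , ci))


      bound : ∀ x → count (uncurry either? (remQuot q x)) ≤ Δ + Δ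
      bound x = let t , t′ = remQuot q x in
        ≤-trans (count-∪ (mixed? i j t t′) (mixed? j i t t′))
                (+-mono-≤ (count-mixed≤Δ deg≤Δ i j t t′) (count-mixed≤Δ deg≤Δ j i t t′))

    layout-from-agreement : s ≤ q → ∀ {Q} → LocallyAgrees q onStack Q → HasLayout s q (edges G)
    layout-from-agreement s≤q {Q} agrees =
      layout-from-layerings Q (proj₂ (Stacks.mirsky s no-crossing-chain)) (proj₂ (Queues.mirsky q no-nesting-chain))
      where
      module Stacks = Mirsky (T? ∘ Q) crossing? crossing-trans (toℕ ∘ u) proj₁
      module Queues = Mirsky (¬? ∘ T? ∘ Q) nesting? nesting-trans (toℕ ∘ u) proj₁

      no-crossing-chain : ∀ ch → ¬ Stacks.Chain {suc s} ch
      no-crossing-chain ch (on-stacks , descending) =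
        let i , avoids , agree = agreement-on-family agrees (≤-trans (s≤s s≤q) (≤-reflexive (+-comm 1 q))) ch
            a , b , a<b , _ , ca , cb = pigeonhole-inj₁ (n<1+n s) (colour i ∘ ch) (λ t → subst T (agree t) (on-stacks t))
        in stack-safe (avoids b) (avoids a) cb ca (Crossing⇒Cross (descending a<b))

      no-nesting-chain : ∀ ch → ¬ Queues.Chain {suc q} ch
      no-nesting-chain ch (on-queues , descending) =
        let i , avoids , agree = agreement-on-family agrees (≤-reflexive (+-comm 1 q)) ch
            a , b , a<b , _ , ca , cb = pigeonhole-inj₂ (n<1+n q) (colour i ∘ ch) (λ t → subst (¬_ ∘ T) (agree t) (on-queues t))
        in queue-safe (avoids b) (avoids a) cb ca (Nesting⇒Nest (descending a<b))

lemma21 : (s q Δ : ℕ) → 1 ≤ s → s ≤ q →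
          (G : OrdGraph) → Separated G → MaxDegree G Δ → Critical s q G →
          (N : ℕ) → IsN q (2 * Δ * s * q) N →
          numEdges G ≤ N
lemma21 (suc s) q Δ _ s≤q G separated (deg≤Δ , _) (no-layout , deletion-layouts) N (N-works , _)
  with numEdges G ≤? N
... | yes m≤N = m≤N
... | no  m≰N = ⊥-elim (no-layout (layout-from-agreement s≤q (proj₂ agreement)))
  where
  open SeparatedGraph G separated
  open Deletions (inj₁ zero) deletion-layouts
  agreement = N-works (numEdges G) (≰⇒> m≰N) onStack (diffCount-onStack deg≤Δ)
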